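{- Let $G$ be a finite simple graph and $n \geq 2$ an integer. (1) If $G$ admits a $C_3$-decomposition, then $G \times K_n$ admits a $C_6$-decomposition. (2) If $G$ admits a $C_6$-decomposition, then $G \times K_n$ admits a $C_6$-decomposition.
   Context: $K_n$ is the complete graph on $n$ vertices, $C_k$ the cycle of length $k$. The tensor product $G \times H$ has vertex set $V(G)\times V(H)$, with $(g_1,h_1)$ adjacent to $(g_2,h_2)$ iff $g_1g_2 \in E(G)$ and $h_1h_2 \in E(H)$. A $C_k$-decomposition of a graph is a partition of its edge set into edge sets of subgraphs isomorphic to $C_k$. -}

module Defs where

open import Data.Nat using (ℕ; zero; suc)
open import Data.Nat.DivMod using (_%_; m%n<n)
open import Data.Fin using (Fin; toℕ; fromℕ<)
open import Data.Product using (Σ; ∃; ∃!; _×_; _,_)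
open import Data.Sum using (_⊎_)
open import Relation.Binary.PropositionalEquality using (_≡_; _≢_)
open import Relation.Nullary using (¬_)
import Data.Empty
open import Function using (Injective)
open import Function.Bundles using (_↔_)

record SimpleGraph (V : Set) : Set₁ where
  field
    Adj    : V → V → Set
    sym    : ∀ {x y} → Adj x y → Adj y x
    irrefl : ∀ {x} → ¬ Adj x x
open SimpleGraph public

Finite : Set → Set
Finite V = Σ ℕ λ N → V ↔ Fin N

K : (n : ℕ) → SimpleGraph (Fin n)
K n = record { Adj = λ i j → i ≢ j ; sym = λ p q → p (Relation.Binary.PropositionalEquality.sym q) ; irrefl = λ p → p _≡_.refl }

_⊗_ : ∀ {V W} → SimpleGraph V → SimpleGraph W → SimpleGraph (V × W)
G ⊗ H = record
  { Adj    = λ { (g₁ , h₁) (g₂ , h₂) → Adj G g₁ g₂ × Adj H h₁ h₂ }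
  ; sym    = λ { (p , q) → SimpleGraph.sym G p , SimpleGraph.sym H q }
  ; irrefl = λ { (p , q) → irrefl G p }
  }

next : ∀ {m} → Fin (suc m) → Fin (suc m)
next {m} i = fromℕ< (m%n<n (suc (toℕ i)) (suc m))

-- a cycle of length suc m in G (used with suc m ∈ {3, 6}): distinct vertices
-- c 0, …, c m with c i adjacent to c (i+1 mod (suc m))
record Cycle {V : Set} (G : SimpleGraph V) (m : ℕ) : Set where
  field
    verts    : Fin (suc m) → V
    distinct : Injective _≡_ _≡_ verts
    adj      : ∀ i → Adj G (verts i) (verts (next i))
open Cycle public

EdgeOf : ∀ {V} {G : SimpleGraph V} {m} → Cycle G m → V → V → Set
EdgeOf c u v = ∃ λ i → (verts c i ≡ u × verts c (next i) ≡ v)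
                     ⊎ (verts c i ≡ v × verts c (next i) ≡ u)

-- C_k-decomposition, k = suc m: a finite family of k-cycles of G such that
-- every edge of G lies in exactly one cycle of the family
-- (cycle edges are edges of G by the field adj).
Decomposition : ∀ {V} → (k : ℕ) → SimpleGraph V → Set
Decomposition zero    G = Data.Empty.⊥
Decomposition (suc m) G =
  Σ ℕ λ t → Σ (Fin t → Cycle G m) λ cs →
    ∀ u v → Adj G u v → ∃! _≡_ (λ j → EdgeOf (cs j) u v)

-- A triangle a₀a₁a₂ of G and a 2-subset {x, y} of K_n lift to the hexagon
-- (a₀,x)(a₁,y)(a₂,x)(a₀,y)(a₁,x)(a₂,y) of G × K_n, in which each edge of the
-- triangle occurs twice, with x and y exchanged; a hexagon a₀…a₅ with an ordered
-- pair (x, y) lifts to (a₀,x)(a₁,y)(a₂,x)(a₃,y)(a₄,x)(a₅,y).  An edge (g,h)(g',h')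
-- of G × K_n lies in exactly one of these lifts: the edge gg' fixes the cycle of
-- the given decomposition of G, and {h, h'} fixes the 2-subset; in the hexagon
-- case gg' also fixes its position in the hexagon, hence which of h, h' sits at an
-- even index, hence the ordered pair.
module Submission where

open import Defs
open import Data.Bool using (Bool; true; false; not)
open import Data.Empty using (⊥; ⊥-elim)
open import Data.Fin using (Fin) renaming (zero to fz; suc to fs)
open import Data.Fin.Patterns using (0F; 1F; 2F; 3F; 4F; 5F)
open import Data.Fin.Properties using (0↔⊥; 2↔Bool; +↔⊎; *↔×; suc-injective)
open import Data.Nat using (ℕ; zero; suc; _+_; _*_; _≥_)
open import Data.Product using (∃; ∃!; _×_; _,_; proj₁; proj₂; swap; map; map₂)
open import Data.Product.Function.NonDependent.Propositional using (_×-↔_)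
open import Data.Sum using (_⊎_; inj₁; inj₂) renaming (swap to ⊎-swap)
open import Data.Sum.Function.Propositional using (_⊎-↔_)
open import Function using (id; _∘_)
open import Function.Bundles using (_↔_; Inverse)
open import Function.Properties.Inverse using (↔-refl; ↔-sym; ↔-trans)
open import Relation.Binary.PropositionalEquality as ≡ using (_≡_; _≢_; refl; trans; cong; cong₂; subst)

Finite-Fin : ∀ n → Finite (Fin n)
Finite-Fin n = n , ↔-refl

Finite-⊥ : Finite ⊥
Finite-⊥ = 0 , ↔-sym 0↔⊥

Finite-Bool : Finite Bool
Finite-Bool = 2 , ↔-sym 2↔Bool

Finite-⊎ : ∀ {A B} → Finite A → Finite B → Finite (A ⊎ B)
Finite-⊎ (m , A↔) (n , B↔) = m + n , ↔-trans (A↔ ⊎-↔ B↔) (↔-sym +↔⊎)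

Finite-× : ∀ {A B} → Finite A → Finite B → Finite (A × B)
Finite-× (m , A↔) (n , B↔) = m * n , ↔-trans (A↔ ×-↔ B↔) (↔-sym *↔×)

∃!-unique : ∀ {A : Set} {P : A → Set} → ∃! _≡_ P → ∀ {x y} → P x → P y → x ≡ y
∃!-unique (_ , _ , uniq) px py = trans (≡.sym (uniq px)) (uniq py)

decomposition-from-finite-family :
  ∀ {W I : Set} {H : SimpleGraph W} {m} → Finite I → (cs : I → Cycle H m) →
  (∀ u v → Adj H u v → ∃ λ i → EdgeOf (cs i) u v) →
  (∀ {u v} → Adj H u v → ∀ {i i'} → EdgeOf (cs i) u v → EdgeOf (cs i') u v → i ≡ i') →
  Decomposition (suc m) H
decomposition-from-finite-family {H = H} (t , I↔Fin) cs covers unique =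
  t , cs ∘ from , λ u v uv → unique-index uv (covers u v uv)
  where
  open Inverse I↔Fin
  unique-index : ∀ {u v} → Adj H u v → ∃ (λ i → EdgeOf (cs i) u v) →
                 ∃! _≡_ (λ x → EdgeOf (cs (from x)) u v)
  unique-index {u} {v} uv (i , e) =
      to i
    , subst (λ i → EdgeOf (cs i) u v) (≡.sym (strictlyInverseʳ i)) e
    , λ {x} e' → trans (cong to (unique uv e e')) (strictlyInverseˡ x)

Step : ∀ {A : Set} {m} → (Fin (suc m) → A) → Fin (suc m) → A → A → Set
Step f k u v = f k ≡ u × f (next k) ≡ v

EdgeOf-sym : ∀ {V} {G : SimpleGraph V} {m} (c : Cycle G m) {u v} → EdgeOf c u v → EdgeOf c v u
EdgeOf-sym c = map₂ ⊎-swap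

next∘next-has-no-fixed-point : (k : Fin 6) → next (next k) ≢ k
next∘next-has-no-fixed-point 0F ()
next∘next-has-no-fixed-point 1F ()
next∘next-has-no-fixed-point 2F ()
next∘next-has-no-fixed-point 3F ()
next∘next-has-no-fixed-point 4F ()
next∘next-has-no-fixed-point 5F ()

hexagon-step-not-reversed : ∀ {V} {G : SimpleGraph V} (c : Cycle G 5) {k k' u v} →
  Step (verts c) k u v → Step (verts c) k' v u → ⊥
hexagon-step-not-reversed c {k} {k'} (ck≡u , cnk≡v) (ck'≡v , cnk'≡u) =
  next∘next-has-no-fixed-point k' (trans (cong next (≡.sym k≡nk')) nk≡k')
  where
  k≡nk' : k ≡ next k'
  k≡nk' = distinct c (trans ck≡u (≡.sym cnk'≡u))
  nk≡k' : next k ≡ k'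
  nk≡k' = distinct c (trans cnk≡v (≡.sym ck'≡v))

par : Fin 6 → Bool
par 0F = true
par 1F = false
par 2F = true
par 3F = false
par 4F = true
par 5F = false

par-next : ∀ k → par (next k) ≡ not (par k)
par-next 0F = refl
par-next 1F = refl
par-next 2F = refl
par-next 3F = refl
par-next 4F = refl
par-next 5F = refl

mod3 : Fin 6 → Fin 3
mod3 0F = 0F
mod3 1F = 1F
mod3 2F = 2F
mod3 3F = 0F
mod3 4F = 1F
mod3 5F = 2F

mod3-next : ∀ k → mod3 (next k) ≡ next (mod3 k)
mod3-next 0F = refl
mod3-next 1F = refl
mod3-next 2F = refl
mod3-next 3F = refl
mod3-next 4F = refl
mod3-next 5F = refl

-- Fin 6 ≅ Fin 3 × Bool by the Chinese remainder theorem, k ↦ (k mod 3, k even).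
crt : Fin 3 → Bool → Fin 6
crt 0F true  = 0F
crt 1F true  = 4F
crt 2F true  = 2F
crt 0F false = 3F
crt 1F false = 1F
crt 2F false = 5F

crt-mod3-par : ∀ k → crt (mod3 k) (par k) ≡ k
crt-mod3-par 0F = refl
crt-mod3-par 1F = refl
crt-mod3-par 2F = refl
crt-mod3-par 3F = refl
crt-mod3-par 4F = refl
crt-mod3-par 5F = refl

mod3-par-surjective : ∀ k b → ∃ λ k' → mod3 k' ≡ k × par k' ≡ b
mod3-par-surjective 0F true  = crt 0F true , refl , refl
mod3-par-surjective 1F true  = crt 1F true , refl , refl
mod3-par-surjective 2F true  = crt 2F true , refl , refl
mod3-par-surjective 0F false = crt 0F false , refl , refl
mod3-par-surjective 1F false = crt 1F false , refl , refl
mod3-par-surjective 2F false = crt 2F false , refl , refl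

mod3-par-injective : ∀ {k k'} → mod3 k ≡ mod3 k' → par k ≡ par k' → k ≡ k'
mod3-par-injective {k} {k'} m≡ p≡ = begin
  k                      ≡⟨ crt-mod3-par k ⟨
  crt (mod3 k) (par k)   ≡⟨ cong₂ crt m≡ p≡ ⟩
  crt (mod3 k') (par k') ≡⟨ crt-mod3-par k' ⟩
  k'                     ∎
  where open ≡.≡-Reasoning

orient : ∀ {A : Set} → Bool → A × A → A × A
orient true  = id
orient false = swap

orient-not : ∀ {A : Set} b (e : A × A) → orient (not b) e ≡ swap (orient b e)
orient-not true  e = refl
orient-not false e = refl

orient-involutive : ∀ {A : Set} b (e : A × A) → orient b (orient b e) ≡ e
orient-involutive true  e = refl
orient-involutive false e = refl

orient-injective : ∀ {A : Set} b {e e' : A × A} → orient b e ≡ orient b e' → e ≡ e'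
orient-injective b {e} {e'} eq = begin
  e                      ≡⟨ orient-involutive b e ⟨
  orient b (orient b e)  ≡⟨ cong (orient b) eq ⟩
  orient b (orient b e') ≡⟨ orient-involutive b e' ⟩
  e'                     ∎
  where open ≡.≡-Reasoning

orient-map : ∀ {A B : Set} b (f : A → B) (e : A × A) → orient b (map f f e) ≡ map f f (orient b e)
orient-map true  f e = refl
orient-map false f e = refl

orient-distinct : ∀ {A : Set} b {e : A × A} → proj₁ e ≢ proj₂ e → proj₁ (orient b e) ≢ proj₂ (orient b e)
orient-distinct true  e₁≢e₂ = e₁≢e₂
orient-distinct false e₁≢e₂ = e₁≢e₂ ∘ ≡.sym

orient₁-injective : ∀ {A : Set} {e : A × A} → proj₁ e ≢ proj₂ e →
  ∀ {b b'} → proj₁ (orient b e) ≡ proj₁ (orient b' e) → b ≡ b'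
orient₁-injective e₁≢e₂ {true}  {true}  _  = refl
orient₁-injective e₁≢e₂ {true}  {false} eq = ⊥-elim (e₁≢e₂ eq)
orient₁-injective e₁≢e₂ {false} {true}  eq = ⊥-elim (e₁≢e₂ (≡.sym eq))
orient₁-injective e₁≢e₂ {false} {false} _  = refl

layer : ∀ {A : Set} → A × A → Fin 6 → A
layer e k = proj₁ (orient (par k) e)

layer-next : ∀ {A : Set} (e : A × A) k → layer e (next k) ≡ proj₂ (orient (par k) e)
layer-next e k = trans (cong (λ b → proj₁ (orient b e)) (par-next k)) (cong proj₁ (orient-not (par k) e))

layer-next-distinct : ∀ {A : Set} {e : A × A} → proj₁ e ≢ proj₂ e → ∀ k → layer e k ≢ layer e (next k)
layer-next-distinct {e = e} e₁≢e₂ k eq = orient-distinct (par k) e₁≢e₂ (trans eq (layer-next e k))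

-- Pair n encodes the 2-subsets of Fin n: {0, j + 1}, or a 2-subset of Fin (n - 1) shifted by one.
Pair : ℕ → Set
Pair zero    = ⊥
Pair (suc n) = Fin n ⊎ Pair n

Finite-Pair : ∀ n → Finite (Pair n)
Finite-Pair zero    = Finite-⊥
Finite-Pair (suc n) = Finite-⊎ (Finite-Fin n) (Finite-Pair n)

ends : ∀ {n} → Pair n → Fin n × Fin n
ends {suc n} (inj₁ j) = fz , fs j
ends {suc n} (inj₂ p) = map fs fs (ends p)

map-suc-injective : ∀ {n} {e e' : Fin n × Fin n} → map fs fs e ≡ map fs fs e' → e ≡ e'
map-suc-injective eq = cong₂ _,_ (suc-injective (cong proj₁ eq)) (suc-injective (cong proj₂ eq))

ends-distinct : ∀ {n} (p : Pair n) → proj₁ (ends p) ≢ proj₂ (ends p)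
ends-distinct {suc n} (inj₁ j) ()
ends-distinct {suc n} (inj₂ p) eq = ends-distinct p (suc-injective eq)

ends-injective : ∀ {n} (p q : Pair n) → ends p ≡ ends q → p ≡ q
ends-injective {suc n} (inj₁ i) (inj₁ j) eq = cong inj₁ (suc-injective (cong proj₂ eq))
ends-injective {suc n} (inj₁ i) (inj₂ q) ()
ends-injective {suc n} (inj₂ p) (inj₁ j) ()
ends-injective {suc n} (inj₂ p) (inj₂ q) eq = cong inj₂ (ends-injective p q (map-suc-injective eq))

ends-not-swapped : ∀ {n} (p q : Pair n) → ends p ≢ swap (ends q)
ends-not-swapped {suc n} (inj₁ i) (inj₁ j) ()
ends-not-swapped {suc n} (inj₁ i) (inj₂ q) ()
ends-not-swapped {suc n} (inj₂ p) (inj₁ j) ()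
ends-not-swapped {suc n} (inj₂ p) (inj₂ q) eq = ends-not-swapped p q (map-suc-injective eq)

Dart : ℕ → Set
Dart n = Bool × Pair n

Finite-Dart : ∀ n → Finite (Dart n)
Finite-Dart n = Finite-× Finite-Bool (Finite-Pair n)

dart-ends : ∀ {n} → Dart n → Fin n × Fin n
dart-ends (b , p) = orient b (ends p)

dart-ends-distinct : ∀ {n} (d : Dart n) → proj₁ (dart-ends d) ≢ proj₂ (dart-ends d)
dart-ends-distinct (b , p) = orient-distinct b (ends-distinct p)

dart-ends-injective : ∀ {n} (d d' : Dart n) → dart-ends d ≡ dart-ends d' → d ≡ d'
dart-ends-injective (true  , p) (true  , q) eq = cong (true ,_) (ends-injective p q eq)
dart-ends-injective (true  , p) (false , q) eq = ⊥-elim (ends-not-swapped p q eq)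
dart-ends-injective (false , p) (true  , q) eq = ⊥-elim (ends-not-swapped q p (≡.sym eq))
dart-ends-injective (false , p) (false , q) eq = cong (false ,_) (ends-injective p q (cong swap eq))

dart-ends-surjective : ∀ {n} {h₁ h₂ : Fin n} → h₁ ≢ h₂ → ∃ λ d → dart-ends d ≡ (h₁ , h₂)
dart-ends-surjective {suc n} {fz}    {fz}    h₁≢h₂ = ⊥-elim (h₁≢h₂ refl)
dart-ends-surjective {suc n} {fz}    {fs j}  h₁≢h₂ = (true , inj₁ j) , refl
dart-ends-surjective {suc n} {fs i}  {fz}    h₁≢h₂ = (false , inj₁ i) , refl
dart-ends-surjective {suc n} {fs i}  {fs j}  h₁≢h₂ with dart-ends-surjective (h₁≢h₂ ∘ cong fs)
... | (b , p) , eq = (b , inj₂ p) , trans (orient-map b fs (ends p)) (cong (map fs fs) eq)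

-- π wraps the hexagon around c: the identity for a hexagon, k ↦ k mod 3 for a triangle.
module Lift {V : Set} {G : SimpleGraph V} {m} (c : Cycle G m) (π : Fin 6 → Fin (suc m))
  (π-next : ∀ k → π (next k) ≡ next (π k))
  (π-par-injective : ∀ {k k'} → π k ≡ π k' → par k ≡ par k' → k ≡ k')
  {n : ℕ} {e : Fin n × Fin n} (e₁≢e₂ : proj₁ e ≢ proj₂ e) where

  lift-verts : Fin 6 → V × Fin n
  lift-verts k = verts c (π k) , layer e k

  lift : Cycle (G ⊗ K n) 5
  lift = record
    { verts    = lift-verts
    ; distinct = λ eq → π-par-injective (distinct c (cong proj₁ eq)) (orient₁-injective e₁≢e₂ (cong proj₂ eq))
    ; adj      = λ k → subst (Adj G (verts c (π k))) (cong (verts c) (≡.sym (π-next k))) (adj c (π k))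
                     , layer-next-distinct e₁≢e₂ k
    }

  step-down : ∀ {k g₁ g₂ h₁ h₂} → Step lift-verts k (g₁ , h₁) (g₂ , h₂) →
    Step (verts c) (π k) g₁ g₂ × orient (par k) e ≡ (h₁ , h₂)
  step-down {k} (s₁ , s₂) =
      (cong proj₁ s₁ , trans (cong (verts c) (≡.sym (π-next k))) (cong proj₁ s₂))
    , cong₂ _,_ (cong proj₂ s₁) (trans (≡.sym (layer-next e k)) (cong proj₂ s₂))

  step-up : ∀ {k g₁ g₂ h₁ h₂} → Step (verts c) (π k) g₁ g₂ → orient (par k) e ≡ (h₁ , h₂) →
    Step lift-verts k (g₁ , h₁) (g₂ , h₂)
  step-up {k} (v₁ , v₂) o =
      cong₂ _,_ v₁ (cong proj₁ o)
    , cong₂ _,_ (trans (cong (verts c) (π-next k)) v₂) (trans (layer-next e k) (cong proj₂ o))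

  lift-edge⇒edge : ∀ {g₁ g₂ h₁ h₂} → EdgeOf lift (g₁ , h₁) (g₂ , h₂) → EdgeOf c g₁ g₂
  lift-edge⇒edge (k , inj₁ s) = π k , inj₁ (proj₁ (step-down s))
  lift-edge⇒edge (k , inj₂ s) = π k , inj₂ (proj₁ (step-down s))

  lift-edge-ends : ∀ {g₁ g₂ h₁ h₂} → EdgeOf lift (g₁ , h₁) (g₂ , h₂) → ∃ λ b → orient b e ≡ (h₁ , h₂)
  lift-edge-ends (k , inj₁ s) = par k , proj₂ (step-down s)
  lift-edge-ends (k , inj₂ s) = not (par k) , trans (orient-not (par k) e) (cong swap (proj₂ (step-down s)))

module FromTriangles {V : Set} {G : SimpleGraph V} {t} (cs : Fin t → Cycle G 2)
  (unique-cycle : ∀ u v → Adj G u v → ∃! _≡_ (λ j → EdgeOf (cs j) u v)) (n : ℕ) where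

  module L (j : Fin t) (p : Pair n) = Lift (cs j) mod3 mod3-next mod3-par-injective (ends-distinct p)

  hexagons : Fin t × Pair n → Cycle (G ⊗ K n) 5
  hexagons (j , p) = L.lift j p

  covers-step : ∀ {j k g₁ g₂ h₁ h₂} → Step (verts (cs j)) k g₁ g₂ → h₁ ≢ h₂ →
    ∃ λ i → EdgeOf (hexagons i) (g₁ , h₁) (g₂ , h₂)
  covers-step {j} {k} s h₁≢h₂ with dart-ends-surjective h₁≢h₂
  ... | (b , p) , o with mod3-par-surjective k b
  ...   | k' , refl , refl = (j , p) , k' , inj₁ (L.step-up j p s o)

  covers : ∀ u v → Adj (G ⊗ K n) u v → ∃ λ i → EdgeOf (hexagons i) u v
  covers (g₁ , h₁) (g₂ , h₂) (g₁g₂ , h₁≢h₂) with unique-cycle g₁ g₂ g₁g₂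
  ... | j , (_ , inj₁ s) , _ = covers-step {j} s h₁≢h₂
  ... | j , (_ , inj₂ s) , _ with covers-step {j} s (h₁≢h₂ ∘ ≡.sym)
  ...   | i , e = i , EdgeOf-sym (hexagons i) e

  unique : ∀ {u v} → Adj (G ⊗ K n) u v → ∀ {i i'} → EdgeOf (hexagons i) u v → EdgeOf (hexagons i') u v → i ≡ i'
  unique {g₁ , _} {g₂ , _} (g₁g₂ , _) {j , p} {j' , p'} e e'
    with L.lift-edge-ends j p e | L.lift-edge-ends j' p' e'
  ... | b , o | b' , o' =
    cong₂ _,_
      (∃!-unique (unique-cycle g₁ g₂ g₁g₂) (L.lift-edge⇒edge j p e) (L.lift-edge⇒edge j' p' e'))
      (cong proj₂ (dart-ends-injective (b , p) (b' , p') (trans o (≡.sym o'))))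

  decomposition : Decomposition 6 (G ⊗ K n)
  decomposition = decomposition-from-finite-family (Finite-× (Finite-Fin t) (Finite-Pair n)) hexagons covers unique

module FromHexagons {V : Set} {G : SimpleGraph V} {t} (cs : Fin t → Cycle G 5)
  (unique-cycle : ∀ u v → Adj G u v → ∃! _≡_ (λ j → EdgeOf (cs j) u v)) (n : ℕ) where

  module L (j : Fin t) (d : Dart n) = Lift (cs j) id (λ _ → refl) (λ k≡k' _ → k≡k') (dart-ends-distinct d)

  hexagons : Fin t × Dart n → Cycle (G ⊗ K n) 5
  hexagons (j , d) = L.lift j d

  covers-step : ∀ {j k g₁ g₂ h₁ h₂} → Step (verts (cs j)) k g₁ g₂ → h₁ ≢ h₂ →
    ∃ λ i → EdgeOf (hexagons i) (g₁ , h₁) (g₂ , h₂)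
  covers-step {j} {k} {h₁ = h₁} {h₂} s h₁≢h₂
    with dart-ends-surjective (orient-distinct (par k) {h₁ , h₂} h₁≢h₂)
  ... | d , o = (j , d) , k , inj₁ (L.step-up j d s o')
    where
    o' : orient (par k) (dart-ends d) ≡ (h₁ , h₂)
    o' = trans (cong (orient (par k)) o) (orient-involutive (par k) (h₁ , h₂))

  covers : ∀ u v → Adj (G ⊗ K n) u v → ∃ λ i → EdgeOf (hexagons i) u v
  covers (g₁ , h₁) (g₂ , h₂) (g₁g₂ , h₁≢h₂) with unique-cycle g₁ g₂ g₁g₂
  ... | j , (_ , inj₁ s) , _ = covers-step {j} s h₁≢h₂
  ... | j , (_ , inj₂ s) , _ with covers-step {j} s (h₁≢h₂ ∘ ≡.sym)
  ...   | i , e = i , EdgeOf-sym (hexagons i) e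

  -- The step of c is at a unique position k, and par k then orients both darts alike.
  same-step-same-ends : ∀ {j d d' k k' u v} → Step (L.lift-verts j d) k u v → Step (L.lift-verts j d') k' u v → d ≡ d'
  same-step-same-ends {j} {d} {d'} {k} s s' with L.step-down j d s | L.step-down j d' s'
  ... | (v , _) , o | (v' , _) , o' with distinct (cs j) (trans v (≡.sym v'))
  ...   | refl = dart-ends-injective d d' (orient-injective (par k) (trans o (≡.sym o')))

  same-cycle-same-dart : ∀ {j d d' u v} → EdgeOf (hexagons (j , d)) u v → EdgeOf (hexagons (j , d')) u v → d ≡ d'
  same-cycle-same-dart (_ , inj₁ s) (_ , inj₁ s') = same-step-same-ends s s'
  same-cycle-same-dart (_ , inj₂ s) (_ , inj₂ s') = same-step-same-ends s s'
  same-cycle-same-dart {j} {d} {d'} (_ , inj₁ s) (_ , inj₂ s') =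
    ⊥-elim (hexagon-step-not-reversed (cs j) (proj₁ (L.step-down j d s)) (proj₁ (L.step-down j d' s')))
  same-cycle-same-dart {j} {d} {d'} (_ , inj₂ s) (_ , inj₁ s') =
    ⊥-elim (hexagon-step-not-reversed (cs j) (proj₁ (L.step-down j d s)) (proj₁ (L.step-down j d' s')))

  unique : ∀ {u v} → Adj (G ⊗ K n) u v → ∀ {i i'} → EdgeOf (hexagons i) u v → EdgeOf (hexagons i') u v → i ≡ i'
  unique {g₁ , _} {g₂ , _} (g₁g₂ , _) {j , d} {j' , d'} e e'
    with ∃!-unique (unique-cycle g₁ g₂ g₁g₂) (L.lift-edge⇒edge j d e) (L.lift-edge⇒edge j' d' e')
  ... | refl = cong (j ,_) (same-cycle-same-dart e e')

  decomposition : Decomposition 6 (G ⊗ K n)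
  decomposition = decomposition-from-finite-family (Finite-× (Finite-Fin t) (Finite-Dart n)) hexagons covers unique

corollary7p2 : ∀ {V : Set} → Finite V → (G : SimpleGraph V) → (n : ℕ) → n ≥ 2 →
    (Decomposition 3 G → Decomposition 6 (G ⊗ K n))
    × (Decomposition 6 G → Decomposition 6 (G ⊗ K n))
corollary7p2 _ G n _ =
    (λ { (_ , cs , unique-cycle) → FromTriangles.decomposition cs unique-cycle n })
  , (λ { (_ , cs , unique-cycle) → FromHexagons.decomposition cs unique-cycle n })
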